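{- Let $U,V$ be non-empty sets with $V$ finite, and let $E\subseteq U\times V$. Suppose that for every $S\subseteq U$ with $|S|\leq|V|$ there exists $v\in V$ such that $(s,v)\in E$ for all $s\in S$. Then there exists $x\in V$ such that $(u,x)\in E$ for all $u\in U$. -}

module Defs where

-- Argue by contradiction: if no x ∈ V is adjacent to all of U, choose for
-- each x a vertex w x ∈ U not adjacent to x. The |V| chosen vertices have a
-- common neighbour v by hypothesis, yet w v is not adjacent to v.
module Submission where

open import Defs
open import Level using (Level; 0ℓ)
open import Axiom.ExcludedMiddle using (ExcludedMiddle)
open import Axiom.DoubleNegationElimination using (em⇒dne)
open import Data.Nat using (ℕ; suc; _≤_)
open import Data.Nat.Properties using (≤-reflexive)
open import Data.Fin using (Fin)
open import Data.List using (List; length; tabulate)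
open import Data.List.Properties using (length-tabulate)
open import Data.List.Relation.Unary.All using (All)
open import Data.List.Relation.Unary.All.Properties using (tabulate⁻)
open import Data.Product using (∃; _,_; proj₁; proj₂)
open import Function using (_∘_)
open import Relation.Nullary using (¬_)
open import Relation.Nullary.Negation using (¬∃⟶∀¬)

private
  variable
    ℓ : Level

¬∀⇒∃¬ : ExcludedMiddle ℓ → {A : Set ℓ} {P : A → Set ℓ} →
        ¬ (∀ x → P x) → ∃ λ x → ¬ P x
¬∀⇒∃¬ em ¬∀P = dne λ ¬∃¬P → ¬∀P λ x → dne (¬∃⟶∀¬ ¬∃¬P x)
  where dne = em⇒dne em

refuters-have-no-common-neighbour :
  {n : ℕ} {U : Set} {E : U → Fin n → Set} (w : Fin n → U) →
  (∀ x → ¬ E (w x) x) → ¬ ∃ λ v → All (λ s → E s v) (tabulate w)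
refuters-have-no-common-neighbour w refutes (v , adjacent) =
  refutes v (tabulate⁻ adjacent v)

lemma8p2 : ExcludedMiddle 0ℓ →
    (m : ℕ) (U : Set) (E : U → Fin (suc m) → Set) → U →
    ((S : List U) → length S ≤ suc m → ∃ λ v → All (λ s → E s v) S) →
    ∃ λ x → ∀ u → E u x
lemma8p2 em m U E _ commonNeighbour = em⇒dne em λ noUniversal →
  let refuter : ∀ x → ∃ λ u → ¬ E u x
      refuter x = ¬∀⇒∃¬ em (¬∃⟶∀¬ noUniversal x)
      w : Fin (suc m) → U
      w = proj₁ ∘ refuter
  in refuters-have-no-common-neighbour w (proj₂ ∘ refuter)
       (commonNeighbour (tabulate w) (≤-reflexive (length-tabulate w)))
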